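{- If a stream $S$ underlies a tick stream $\dot{S}$, then $\tau_n(S)$ underlies $\tau_n(\dot{S})$.
   Context: A stream $S=(T,\upsilon)$ consists of a timeline $T$ (a closed nonempty interval in $\mathbb{N}$) and an evaluation function $\upsilon:\mathbb{N}\to 2^A$ assigning a set of atoms to each time point. A window of $S$ is a stream $S'=(T',\upsilon')$ with $T'\subseteq T$ and $\upsilon'(t)\subseteq\upsilon(t)$ for all $t\in T'$. A tick is a pair $(t,c)\in\mathbb{N}^2$; $(t+1,c)$ is its time increment and $(t,c+1)$ its count increment. A tick pattern is a sequence $K=\langle k_1,\dots,k_m\rangle$, $m\ge 1$, of ticks where each $k_{i+1}$ is a time or count increment of $k_i$. A tick stream is a pair $\dot{S}=(K,v)$ with $K$ a tick pattern and $v$ an evaluation function such that $v(k_{i+1})=\{a\}$ for some atom $a$ if $k_{i+1}$ is a count increment of $k_i$, and $v(k_{i+1})=\emptyset$ otherwise. For $K=\langle (t_1,c_1),\dots,(t_m,c_m)\rangle$, a stream $S=(T,\upsilon)$ underlies $\dot{S}$ (equivalently, $\dot{S}$ is an ordering of $S$) if $T=[t_1,t_m]$ and $\upsilon(t)=\bigcup\{v(t,c)\mid (t,c)\in K\}$ for all $t\in T$. The sliding time-based window on a stream is $\tau_n(S,t)=(T',\upsilon|_{T'})$ with $T'=[\max\{t_1,t-n\},t]$ where $T=[t_1,t_m]$; on a tick stream it is $\tau_n(\dot{S},(t,c))=(K',v|_{K'})$ with $K'=\{(t',c')\in K\mid \max\{t_1,t-n\}\le t'\le t\}$, where $v|_{K'}$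 is the restriction of $v$ to $K'$. With a single argument, window functions are applied at the end of the timeline: $\tau_n(S)=\tau_n(S,t_m)$ and $\tau_n(\dot{S})=\tau_n(\dot{S},(t_m,c_m))$. -}

module Defs where

open import Data.Nat using (ℕ; suc; _≤_; _⊔_; _∸_; _≤?_)
import Data.Nat.Properties as ℕP
open import Data.Product using (_×_; _,_; proj₁; proj₂; ∃; Σ)
import Data.Product.Properties as ×P
open import Data.Sum using (_⊎_)
open import Data.Empty using (⊥)
open import Data.List using (List; []; _∷_; filter)
open import Data.List.NonEmpty using (List⁺; _∷_; toList; head)
import Data.List.NonEmpty as L⁺
open import Data.List.Relation.Unary.Linked using (Linked)
open import Data.List.Membership.Propositional using (_∈_)
import Data.List.Membership.DecPropositional as DecMem
open import Relation.Binary.PropositionalEquality using (_≡_)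
open import Relation.Nullary using (Dec; yes; no)
open import Relation.Nullary.Decidable using (_×-dec_)
open import Function.Bundles using (_⇔_)

SetOf : Set → Set₁
SetOf A = A → Set

_≐_ : {A : Set} → SetOf A → SetOf A → Set
P ≐ Q = ∀ a → P a ⇔ Q a

∅ : {A : Set} → SetOf A
∅ _ = ⊥

｛_｝ : {A : Set} → A → SetOf A
｛ a ｝ b = b ≡ a

record Stream (A : Set) : Set₁ where
  field
    first : ℕ
    final : ℕ
    first≤final : first ≤ final
    val   : ℕ → SetOf A
open Stream public

InT : {A : Set} → Stream A → ℕ → Set
InT S t = first S ≤ t × t ≤ final S

Tick : Set
Tick = ℕ × ℕ

time : Tick → ℕ
time = proj₁

timeInc : Tick → Tick
timeInc (t , c) = (suc t , c)

countInc : Tick → Tick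
countInc (t , c) = (t , suc c)

Step : Tick → Tick → Set
Step k k' = (k' ≡ timeInc k) ⊎ (k' ≡ countInc k)

IsTickPattern : List⁺ Tick → Set
IsTickPattern K = Linked Step (toList K)

ValidStep : {A : Set} → (Tick → SetOf A) → Tick → Tick → Set
ValidStep v k k' =
  (k' ≡ countInc k × ∃ λ a → v k' ≐ ｛ a ｝) ⊎ (k' ≡ timeInc k × v k' ≐ ∅)

record TickStream (A : Set) : Set₁ where
  field
    ticks   : List⁺ Tick
    isTickPattern : IsTickPattern ticks
    tval      : Tick → SetOf A
    validVal  : Linked (ValidStep tval) (toList ticks)
open TickStream public

Underlies : {A : Set} → Stream A → List Tick → (Tick → SetOf A) → Set
Underlies S [] v = ⊥
Underlies S (k ∷ ks) v =
  first S ≡ time k × final S ≡ time (L⁺.last (k ∷ ks)) ×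
  (∀ t → InT S t →
     val S t ≐ (λ a → ∃ λ c → ((t , c) ∈ (k ∷ ks)) × v (t , c) a))

restrict : {A : Set} {X : Set} {P : X → Set} → (∀ x → Dec (P x)) →
           (X → SetOf A) → X → SetOf A
restrict P? f x with P? x
... | yes _ = f x
... | no  _ = ∅

τ : {A : Set} → ℕ → (S : Stream A) → (t : ℕ) → first S ≤ t → Stream A
τ n S t t₁≤t = record
  { first = first S ⊔ (t ∸ n)
  ; final = t
  ; first≤final = lemma
  ; val   = restrict (λ t' → (first S ⊔ (t ∸ n)) ≤? t' ×-dec t' ≤? t) (val S)
  }
  where
    lemma = ℕP.⊔-lub t₁≤t (ℕP.m∸n≤m t n)

τₙ : {A : Set} → ℕ → Stream A → Stream A
τₙ n S = τ n S (final S) (first≤final S)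

private
  open module M = DecMem (×P.≡-dec ℕP._≟_ ℕP._≟_)
    using (_∈?_)

inWin : ℕ → ℕ → ℕ → Tick → Set
inWin t₁ n t k = (t₁ ⊔ (t ∸ n)) ≤ time k × time k ≤ t

inWin? : ∀ t₁ n t k → Dec (inWin t₁ n t k)
inWin? t₁ n t k = ((t₁ ⊔ (t ∸ n)) ≤? time k) ×-dec (time k ≤? t)

τ̇-ticks : {A : Set} → ℕ → TickStream A → Tick → List Tick
τ̇-ticks n Ṡ (t , c) =
  filter (inWin? (time (head (ticks Ṡ))) n t) (toList (ticks Ṡ))

τ̇-val : {A : Set} → ℕ → TickStream A → Tick → Tick → SetOf A
τ̇-val n Ṡ k = restrict (λ k' → k' ∈? τ̇-ticks n Ṡ k) (tval Ṡ)

τ̇ₙ-ticks : {A : Set} → ℕ → TickStream A → List Tick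
τ̇ₙ-ticks n Ṡ = τ̇-ticks n Ṡ (L⁺.last (ticks Ṡ))

τ̇ₙ-val : {A : Set} → ℕ → TickStream A → Tick → SetOf A
τ̇ₙ-val n Ṡ = τ̇-val n Ṡ (L⁺.last (ticks Ṡ))

-- Tick times never decrease and grow by at most one per tick.  Hence the last
-- tick carries the latest time t_m, and the first tick whose time reaches the
-- window start w = max(t₁, t_m − n) has time exactly w; together with the last
-- tick, which lies in the window, this gives the timeline [w, t_m] of the
-- windowed tick stream.  The window is a condition on time only, so for every
-- time point in it all of its ticks, with their atoms, are kept.
module Submission where

open import Defs
open import Data.Nat using (ℕ; suc; _≤_; _⊔_; _∸_; _≤?_)
open import Data.Nat.Properties using (≤-refl; ≤-trans; ≤-antisym; n≤1+n; ≰⇒>; m≤m⊔n; m∸n≤m; ⊔-lub)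
open import Data.Product using (_×_; _,_; proj₁; ∃; ∃₂)
open import Data.Sum using (inj₁; inj₂)
open import Data.Empty using (⊥-elim)
open import Data.List using (List; []; _∷_; _∷ʳ_; filter)
open import Data.List.NonEmpty as L⁺ using (List⁺; _∷_; toList; snocView; _∷ʳ′_)
open import Data.List.Relation.Unary.Linked as Linked using (Linked; _∷_)
open import Data.List.Relation.Unary.Any using (here; there)
open import Data.List.Membership.Propositional using (_∈_)
open import Data.List.Membership.Propositional.Properties using (∈-filter⁺; ∈-filter⁻)
open import Relation.Binary.Core using (Rel)
open import Relation.Binary.Definitions using (Reflexive; Transitive)
open import Relation.Binary.PropositionalEquality using (_≡_; refl; sym; trans; cong; cong₂; subst; module ≡-Reasoning)
open import Relation.Nullary using (yes; no)
open import Relation.Nullary.Decidable using (_×-dec_)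
open import Relation.Unary using (Pred; Decidable)
open import Function.Base using (_∘′_)
open import Function.Bundles using (_⇔_; mk⇔; Equivalence)
open import Function.Properties.Equivalence using () renaming (refl to ⇔-refl; trans to ⇔-trans)
import Data.Nat.Properties as ℕ
import Data.Product.Properties as ×
open import Data.List.Membership.DecPropositional (×.≡-dec ℕ._≟_ ℕ._≟_) using (_∈?_)

private
  variable
    A X : Set

-- L⁺.last is computed through a snoc view, which does not reduce on
-- x ∷ xs; lastFrom is its structurally recursive form.
private
  lastFrom : A → List A → A
  lastFrom d []       = d
  lastFrom d (x ∷ xs) = lastFrom x xs

  lastFrom-∷ʳ : (d : A) (xs : List A) (x : A) → lastFrom d (xs ∷ʳ x) ≡ x
  lastFrom-∷ʳ d []       x = refl
  lastFrom-∷ʳ d (y ∷ ys) x = lastFrom-∷ʳ y ys x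

  last≡lastFrom : (xs : List⁺ A) → L⁺.last xs ≡ lastFrom (L⁺.head xs) (L⁺.tail xs)
  last≡lastFrom xs with snocView xs
  ... | []       ∷ʳ′ x = refl
  ... | (y ∷ ys) ∷ʳ′ x = sym (lastFrom-∷ʳ y ys x)

last-∷ : (d x : A) (xs : List A) → L⁺.last (d ∷ x ∷ xs) ≡ L⁺.last (x ∷ xs)
last-∷ d x xs = trans (last≡lastFrom (d ∷ x ∷ xs)) (sym (last≡lastFrom (x ∷ xs)))

module _ {ℓ} {R : Rel A ℓ} (R-refl : Reflexive R) (R-trans : Transitive R) where

  Linked⇒≤last : ∀ {y} (x : A) (xs : List A) → Linked R (x ∷ xs) →
                 y ∈ x ∷ xs → R y (L⁺.last (x ∷ xs))
  Linked⇒≤last x []       _         (here refl) = R-refl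
  Linked⇒≤last x (z ∷ zs) (Rxz ∷ l) (here refl) =
    subst (R x) (sym (last-∷ x z zs)) (R-trans Rxz (Linked⇒≤last z zs l (here refl)))
  Linked⇒≤last x (z ∷ zs) (_ ∷ l)   (there y∈) =
    subst (R _) (sym (last-∷ x z zs)) (Linked⇒≤last z zs l y∈)

module _ {ℓ} {P : Pred A ℓ} (P? : Decidable P) where

  last-filter : (d x : A) (xs : List A) → P (L⁺.last (x ∷ xs)) →
                L⁺.last (d ∷ filter P? (x ∷ xs)) ≡ L⁺.last (x ∷ xs)
  last-filter d x xs       Plast with P? x
  last-filter d x []       _     | yes _  = refl
  last-filter d x []       Px    | no ¬Px = ⊥-elim (¬Px Px)
  last-filter d x (y ∷ ys) Plast | yes _  = begin
    L⁺.last (d ∷ x ∷ filter P? (y ∷ ys)) ≡⟨ last-∷ d x (filter P? (y ∷ ys)) ⟩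
    L⁺.last (x ∷ filter P? (y ∷ ys))     ≡⟨ last-filter x y ys Plast′ ⟩
    L⁺.last (y ∷ ys)                     ≡⟨ sym (last-∷ x y ys) ⟩
    L⁺.last (x ∷ y ∷ ys)                 ∎
    where
      open ≡-Reasoning
      Plast′ : P (L⁺.last (y ∷ ys))
      Plast′ = subst P (last-∷ x y ys) Plast
  last-filter d x (y ∷ ys) Plast | no _   =
    trans (last-filter d y ys (subst P (last-∷ x y ys) Plast)) (sym (last-∷ x y ys))

  -- When f moves up by at most one along the list, the filter for f ≥ w
  -- cannot overshoot w: the element before its first one lies below w.
  filter-head-≡ : (f : A → ℕ) {w : ℕ} (x : A) (xs : List A) →
                  Linked (λ a b → f b ≤ suc (f a)) (x ∷ xs) → f x ≤ w →
                  (∀ {y} → y ∈ x ∷ xs → P y ⇔ w ≤ f y) → P (L⁺.last (x ∷ xs)) →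
                  ∃₂ λ k ks → filter P? (x ∷ xs) ≡ k ∷ ks × f k ≡ w
  filter-head-≡ f x xs _ fx≤w P⇔ _ with P? x
  ... | yes Px = x , filter P? xs , refl
               , ≤-antisym fx≤w (Equivalence.to (P⇔ (here refl)) Px)
  filter-head-≡ f x [] _ _ _ Px | no ¬Px = ⊥-elim (¬Px Px)
  filter-head-≡ f {w} x (y ∷ ys) (fy≤1+fx ∷ l) _ P⇔ Plast | no ¬Px =
      filter-head-≡ f y ys l fy≤w (λ y∈ → P⇔ (there y∈)) (subst P (last-∷ x y ys) Plast)
    where
      fy≤w : f y ≤ w
      fy≤w = ≤-trans fy≤1+fx (≰⇒> (¬Px ∘′ Equivalence.from (P⇔ (here refl))))

restrict-≐ : {P : Pred X _} (P? : Decidable P) (f : X → SetOf A) {x : X} →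
             P x → restrict P? f x ≐ f x
restrict-≐ P? f {x} Px with P? x
... | yes _  = λ _ → ⇔-refl
... | no ¬Px = ⊥-elim (¬Px Px)

Step⇒time≤ : ∀ {k k′} → Step k k′ → time k ≤ time k′
Step⇒time≤ (inj₁ refl) = n≤1+n _
Step⇒time≤ (inj₂ refl) = ≤-refl

Step⇒time≤suc : ∀ {k k′} → Step k k′ → time k′ ≤ suc (time k)
Step⇒time≤suc (inj₁ refl) = ≤-refl
Step⇒time≤suc (inj₂ refl) = n≤1+n _

τ-val≐ : ∀ n (S : Stream A) t first≤t {t′} → InT (τ n S t first≤t) t′ →
         val (τ n S t first≤t) t′ ≐ val S t′
τ-val≐ n S t _ t′∈ = restrict-≐ (λ t′ → (first S ⊔ (t ∸ n)) ≤? t′ ×-dec t′ ≤? t) (val S) t′∈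

underlies-∷ : {S : Stream A} {L : List Tick} {v : Tick → SetOf A} (k : Tick) (ks : List Tick) →
              L ≡ k ∷ ks → first S ≡ time k → final S ≡ time (L⁺.last (k ∷ ks)) →
              (∀ t → InT S t → val S t ≐ (λ a → ∃ λ c → ((t , c) ∈ L) × v (t , c) a)) →
              Underlies S L v
underlies-∷ k ks refl first≡ final≡ val≐ = first≡ , final≡ , val≐

module TickWindow (n : ℕ) (k : Tick) (ks : List Tick) (steps : IsTickPattern (k ∷ ks)) where

  tₘ : ℕ
  tₘ = time (L⁺.last (k ∷ ks))

  start : ℕ
  start = time k ⊔ (tₘ ∸ n)

  window : List Tick
  window = filter (inWin? (time k) n tₘ) (k ∷ ks)

  time≤tₘ : ∀ {k′} → k′ ∈ k ∷ ks → time k′ ≤ tₘ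
  time≤tₘ = Linked⇒≤last ≤-refl ≤-trans k ks (Linked.map Step⇒time≤ steps)

  inWin⇔start≤ : ∀ {k′} → k′ ∈ k ∷ ks → inWin (time k) n tₘ k′ ⇔ start ≤ time k′
  inWin⇔start≤ k′∈ = mk⇔ proj₁ (λ start≤ → start≤ , time≤tₘ k′∈)

  last-inWin : inWin (time k) n tₘ (L⁺.last (k ∷ ks))
  last-inWin = ⊔-lub (time≤tₘ (here refl)) (m∸n≤m tₘ n) , ≤-refl

  window-head : ∃₂ λ k′ ks′ → window ≡ k′ ∷ ks′ × time k′ ≡ start
  window-head = filter-head-≡ (inWin? (time k) n tₘ) time k ks
    (Linked.map Step⇒time≤suc steps) (m≤m⊔n (time k) _) inWin⇔start≤ last-inWin

  window-last : ∀ {k′ ks′} → window ≡ k′ ∷ ks′ → L⁺.last (k′ ∷ ks′) ≡ L⁺.last (k ∷ ks)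
  window-last {k′} {ks′} window≡ = begin
    L⁺.last (k′ ∷ ks′)        ≡⟨ sym (last-∷ k k′ ks′) ⟩
    L⁺.last (k ∷ k′ ∷ ks′)    ≡⟨ cong (λ l → L⁺.last (k ∷ l)) (sym window≡) ⟩
    L⁺.last (k ∷ window)      ≡⟨ last-filter (inWin? (time k) n tₘ) k k ks last-inWin ⟩
    L⁺.last (k ∷ ks)          ∎
    where open ≡-Reasoning

  window-val≐ : ∀ {A} (v : Tick → SetOf A) {t} → start ≤ t → t ≤ tₘ →
                (λ a → ∃ λ c → ((t , c) ∈ k ∷ ks) × v (t , c) a) ≐
                (λ a → ∃ λ c → ((t , c) ∈ window) × restrict (_∈? window) v (t , c) a)
  window-val≐ v {t} start≤t t≤tₘ a = mk⇔
    (λ (c , t,c∈ , va) → let t,c∈w = ∈-filter⁺ (inWin? (time k) n tₘ) t,c∈ (start≤t , t≤tₘ) in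
       c , t,c∈w , Equivalence.from (restrict-≐ (_∈? window) v t,c∈w a) va)
    (λ (c , t,c∈w , va) →
       c , proj₁ (∈-filter⁻ (inWin? (time k) n tₘ) t,c∈w) ,
       Equivalence.to (restrict-≐ (_∈? window) v t,c∈w a) va)

lemma1 : {A : Set} (n : ℕ) (S : Stream A) (Ṡ : TickStream A) →
    Underlies S (toList (ticks Ṡ)) (tval Ṡ) →
    Underlies (τₙ n S) (τ̇ₙ-ticks n Ṡ) (τ̇ₙ-val n Ṡ)
lemma1 n S Ṡ@record { ticks = k ∷ ks ; isTickPattern = steps ; tval = v } (first≡ , final≡ , val≐)
  with TickWindow.window-head n k ks steps
... | k′ , ks′ , window≡ , time≡start = underlies-∷ k′ ks′ window≡ first≡start final≡last val-window≐
  where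
    open TickWindow n k ks steps

    S-start≡ : first S ⊔ (final S ∸ n) ≡ start
    S-start≡ = cong₂ (λ t₁ t → t₁ ⊔ (t ∸ n)) first≡ final≡

    first≡start : first S ⊔ (final S ∸ n) ≡ time k′
    first≡start = trans S-start≡ (sym time≡start)

    final≡last : final S ≡ time (L⁺.last (k′ ∷ ks′))
    final≡last = trans final≡ (cong time (sym (window-last window≡)))

    val-window≐ : ∀ t → InT (τₙ n S) t →
                  val (τₙ n S) t ≐ (λ a → ∃ λ c → ((t , c) ∈ window) × τ̇ₙ-val n Ṡ (t , c) a)
    val-window≐ t (start≤t , t≤final) a =
      ⇔-trans (τ-val≐ n S (final S) (first≤final S) (start≤t , t≤final) a)
      (⇔-trans (val≐ t (≤-trans (m≤m⊔n _ _) start≤t , t≤final) a)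
               (window-val≐ v (subst (_≤ t) S-start≡ start≤t) (subst (t ≤_) final≡ t≤final) a))
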